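{- Let $n, m \geq 1$ and $k \geq 0$ be integers. The following two families of partitions with perimeter $n$ are equinumerous: (1) Partitions $\lambda = (\lambda_1 \geq \lambda_2 \geq \cdots \geq \lambda_\ell)$, $\ell = \ell(\lambda)$, whose parts can be grouped into non-empty disjoint sets of consecutive parts $\{\lambda_1, \dots, \lambda_{t_1}\}, \{\lambda_{t_1+1}, \dots, \lambda_{t_2}\}, \dots$, ending with the set containing $\lambda_\ell$, where the number of sets is $k+1$ if $\lambda_\ell \equiv 1 \pmod{m+1}$, and is $k$ with additionally $\lambda_\ell > m+1$ otherwise; such that all parts within each set belong to the same congruence class modulo $m+1$, neighboring sets have different congruence classes modulo $m+1$, and for any two neighboring sets, the last part $\lambda_{t_i}$ of the earlier set and the first part $\lambda_{t_i+1}$ of the next set satisfy $\lambda_{t_i} - \lambda_{t_i+1} > m$. (2) Partitions $\lambda = (\lambda_1 \geq \cdots \geq \lambda_\ell)$ such that all gaps $\lambda_i - \lambda_{i+1}$ ($1 \leq i < \ell$) are $\geq m$ with exactly $k$ exceptions, i.e. exactly $k$ indices $i$ with $\lambda_i - \lambda_{i+1} < m$, where each such exceptional index $i$ is preceded by a gap $\lambda_{i-1} - \lambda_i \geq m$, and is followed by a gap $\lambda_{i+1} - \lambda_{i+2} > m$ unless $\ell = i+1$.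
   Context: A partition $\lambda = (\lambda_1, \dots, \lambda_\ell)$ is a finite weakly decreasing sequence of positive integers (its parts); $\ell(\lambda) = \ell$ is its number of parts. The perimeter of $\lambda$ is $\lambda_1 + \ell(\lambda) - 1$. The "gaps between parts" are the differences $\lambda_i - \lambda_{i+1}$ for $1 \le i < \ell(\lambda)$. -}

module Defs where

open import Data.Nat using (ℕ; zero; suc; _+_; _∸_; _≤_; _<_; _≥_; _<?_)
open import Data.Nat.DivMod using (_%_)
open import Data.List using (List; []; _∷_; length; filter; _++_; _∷ʳ_; concat; map)
open import Data.List.NonEmpty using (List⁺; _∷_; head; last; toList)
open import Data.List.Relation.Unary.All using (All)
open import Data.List.Relation.Unary.Linked using (Linked)
open import Data.Product using (Σ; ∃; _×_; proj₁; proj₂)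
open import Data.Sum using (_⊎_)
open import Relation.Binary.PropositionalEquality using (_≡_; _≢_)

IsPartition : List⁺ ℕ → Set
IsPartition p = All (λ x → 1 ≤ x) (toList p) × Linked _≥_ (toList p)

numParts : List⁺ ℕ → ℕ
numParts p = length (toList p)

perimeter : List⁺ ℕ → ℕ
perimeter p = head p + numParts p ∸ 1

gapsL : List ℕ → List ℕ
gapsL (x ∷ y ∷ r) = (x ∸ y) ∷ gapsL (y ∷ r)
gapsL _           = []

gaps : List⁺ ℕ → List ℕ
gaps p = gapsL (toList p)

SameClass : ℕ → List⁺ ℕ → Set
SameClass m b = All (λ x → x % suc m ≡ head b % suc m) (toList b)

NeighbourOK : ℕ → List⁺ ℕ → List⁺ ℕ → Set
NeighbourOK m b c = (last b % suc m ≢ head c % suc m) × (m < last b ∸ head c)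

IsGrouping : ℕ → List⁺ ℕ → List (List⁺ ℕ) → Set
IsGrouping m p bs =
  (concat (map toList bs) ≡ toList p) × All (SameClass m) bs × Linked (NeighbourOK m) bs

Family1 : ℕ → ℕ → List⁺ ℕ → Set
Family1 m k p = Σ (List (List⁺ ℕ)) λ bs → IsGrouping m p bs ×
  ( (last p % suc m ≡ 1 % suc m × length bs ≡ suc k)
  ⊎ (last p % suc m ≢ 1 % suc m × length bs ≡ k × suc m < last p) )

numExceptions : ℕ → List⁺ ℕ → ℕ
numExceptions m p = length (filter (_<? m) (gaps p))

ExceptionsIsolated : ℕ → List⁺ ℕ → Set
ExceptionsIsolated m p = ∀ (pre : List ℕ) (g : ℕ) (post : List ℕ) →
  gaps p ≡ pre ++ (g ∷ post) → g < m →
    (∃ λ pre′ → ∃ λ h → pre ≡ pre′ ∷ʳ h × m ≤ h)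
  × (post ≡ [] ⊎ (∃ λ h → ∃ λ post′ → post ≡ h ∷ post′ × m < h))

Family2 : ℕ → ℕ → List⁺ ℕ → Set
Family2 m k p = numExceptions m p ≡ k × ExceptionsIsolated m p

Equinumerous : {A : Set} → (A → Set) → (A → Set) → Set
Equinumerous {A} P Q =
  Σ ((x : A) → P x → Σ A Q) λ f →
  Σ ((y : A) → Q y → Σ A P) λ g →
    (∀ x (px : P x) → proj₁ (g (proj₁ (f x px)) (proj₂ (f x px))) ≡ x)
  × (∀ y (qy : Q y) → proj₁ (f (proj₁ (g y qy)) (proj₂ (g y qy))) ≡ y)

PerimPartition : ℕ → List⁺ ℕ → Set
PerimPartition n p = IsPartition p × perimeter p ≡ n

-- Both families are in bijection, preserving the perimeter n and the statistic k,
-- with the words over the letters one (weight 1), full (weight m+1) and part r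
-- (weight r, 1 ≤ r ≤ m) that end with one and in which every part letter is
-- preceded by full and followed by one; n is the weight of the word and k its
-- number of part letters. Both encodings read a partition through its gaps and
-- its last part a.
--
-- In family (1) the grouping is forced: its blocks are the maximal runs of parts
-- in one class mod m+1. So the conditions say that every gap, and also a − 1, is
-- divisible by m+1 or exceeds m, and k counts the entries that are not divisible.
-- An entry q(m+1) + r is written full^q one if r = 0 and full^q (part r) one
-- otherwise.
--
-- In family (2) a gap g ≥ m is written one^(g−m) full, an exceptional gap g < m is
-- written part (g+1), and the last part a is written one^a. The isolation
-- conditions are exactly the constraints on the part letters.

module Submission where

open import Data.Bool using (if_then_else_)
open import Data.List using (List; []; _∷_; _++_; _∷ʳ_; replicate; length; filter; map; concat; concatMap)
open import Data.List.NonEmpty using (List⁺; _∷_; head; last; toList)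
import Data.List.NonEmpty as List⁺
open import Data.List.Properties using (++-assoc; ++-identityʳ; ∷-injective; ∷ʳ-injective; map-++; map-cong; filter-accept; filter-reject)
open import Data.List.Relation.Unary.All using (All; []; _∷_)
import Data.List.Relation.Unary.All as All
open import Data.List.Relation.Unary.All.Properties using (∷ʳ⁺; ∷ʳ⁻)
open import Data.List.Relation.Unary.Linked using (Linked; []; [-]; _∷_)
open import Data.Nat using (ℕ; zero; suc; _+_; _*_; _∸_; _≤_; _<_; _≥_; z≤n; s≤s)
open import Data.Nat.DivMod
open import Data.Nat.Divisibility using (divides; ∣m+n∣m⇒∣n; m%n≡0⇒n∣m; n∣m⇒m%n≡0)
open import Data.Nat.ListAction using (sum)
open import Data.Nat.ListAction.Properties using (sum-++)
open import Data.Nat.Properties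
open import Data.Product using (Σ; ∃; _×_; _,_; proj₁; proj₂; map₁; map₂; uncurry)
open import Data.Sum using (_⊎_; inj₁; inj₂)
open import Function using (_∘_; id)
open import Function.Bundles using (_⇔_; mk⇔; Equivalence)
open import Relation.Nullary using (Dec; yes; no; does; ¬_; contradiction)
open import Relation.Binary.PropositionalEquality

open import Defs

record _↔ˢ_ {A B : Set} (P : A → Set) (Q : B → Set) : Set where
  field
    to      : A → B
    from    : B → A
    to-∈    : ∀ {x} → P x → Q (to x)
    from-∈  : ∀ {y} → Q y → P (from y)
    from∘to : ∀ {x} → P x → from (to x) ≡ x
    to∘from : ∀ {y} → Q y → to (from y) ≡ y

module _ {A B : Set} {P : A → Set} {Q : B → Set} where

  ↔ˢ-sym : P ↔ˢ Q → Q ↔ˢ P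
  ↔ˢ-sym f = record
    { to = from ; from = to ; to-∈ = from-∈ ; from-∈ = to-∈ ; from∘to = to∘from ; to∘from = from∘to }
    where open _↔ˢ_ f

  ↔ˢ-byEncoding : (encode : A → B) (decode : B → A) →
                  (∀ x → decode (encode x) ≡ x) → (∀ {y} → Q y → encode (decode y) ≡ y) →
                  (∀ x → P x ⇔ Q (encode x)) → P ↔ˢ Q
  ↔ˢ-byEncoding encode decode decode∘encode encode∘decode P⇔Q = record
    { to      = encode
    ; from    = decode
    ; to-∈    = λ {x} → Equivalence.to (P⇔Q x)
    ; from-∈  = λ {y} qy → Equivalence.from (P⇔Q (decode y)) (subst Q (sym (encode∘decode qy)) qy)
    ; from∘to = λ {x} _ → decode∘encode x
    ; to∘from = encode∘decode
    }

infixr 4 _⨾_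
_⨾_ : {A B C : Set} {P : A → Set} {Q : B → Set} {R : C → Set} → P ↔ˢ Q → Q ↔ˢ R → P ↔ˢ R
f ⨾ g = record
  { to      = G.to ∘ F.to
  ; from    = F.from ∘ G.from
  ; to-∈    = λ px → G.to-∈ (F.to-∈ px)
  ; from-∈  = λ rz → F.from-∈ (G.from-∈ rz)
  ; from∘to = λ px → trans (cong F.from (G.from∘to (F.to-∈ px))) (F.from∘to px)
  ; to∘from = λ rz → trans (cong G.to (F.to∘from (G.from-∈ rz))) (G.to∘from rz)
  }
  where
  module F = _↔ˢ_ f
  module G = _↔ˢ_ g

↔ˢ⇒equinumerous : {A : Set} {P Q : A → Set} → P ↔ˢ Q → Equinumerous P Q
↔ˢ⇒equinumerous f = (λ x px → to x , to-∈ px) , (λ y qy → from y , from-∈ qy) , (λ _ → from∘to) , (λ _ → to∘from)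
  where open _↔ˢ_ f

χ¬ : {A : Set} → Dec A → ℕ
χ¬ d = if does d then 0 else 1

module _ {A : Set} where

  χ¬-yes : (d : Dec A) → A → χ¬ d ≡ 0
  χ¬-yes (yes _) _ = refl
  χ¬-yes (no ¬a) a = contradiction a ¬a

  χ¬-no : (d : Dec A) → ¬ A → χ¬ d ≡ 1
  χ¬-no (yes a) ¬a = contradiction a ¬a
  χ¬-no (no _)  _  = refl

  χ¬-cong : {B : Set} → A ⇔ B → (d : Dec A) (e : Dec B) → χ¬ d ≡ χ¬ e
  χ¬-cong A⇔B (yes _) (yes _) = refl
  χ¬-cong A⇔B (yes a) (no ¬b) = contradiction (Equivalence.to A⇔B a) ¬b
  χ¬-cong A⇔B (no ¬a) (yes b) = contradiction (Equivalence.from A⇔B b) ¬a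
  χ¬-cong A⇔B (no _)  (no _)  = refl

  +χ¬-yes : ∀ n (d : Dec A) → A → n + χ¬ d ≡ n
  +χ¬-yes n d a = trans (cong (n +_) (χ¬-yes d a)) (+-identityʳ n)

  +χ¬-no : ∀ n (d : Dec A) → ¬ A → n + χ¬ d ≡ suc n
  +χ¬-no n d ¬a = trans (cong (n +_) (χ¬-no d ¬a)) (+-comm n 1)

total : {A : Set} → (A → ℕ) → List A → ℕ
total f xs = sum (map f xs)

module _ {A : Set} (f : A → ℕ) where

  total-++ : ∀ xs ys → total f (xs ++ ys) ≡ total f xs + total f ys
  total-++ xs ys = trans (cong sum (map-++ f xs ys)) (sum-++ (map f xs) (map f ys))

  total-∷ʳ : ∀ xs x → total f (xs ∷ʳ x) ≡ total f xs + f x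
  total-∷ʳ xs x = trans (total-++ xs (x ∷ [])) (cong (total f xs +_) (+-identityʳ (f x)))

  total-replicate : ∀ n x → total f (replicate n x) ≡ n * f x
  total-replicate zero    x = refl
  total-replicate (suc n) x = cong (f x +_) (total-replicate n x)

  total-concatMap : {B : Set} (g : B → List A) → ∀ xs → total f (concatMap g xs) ≡ total (total f ∘ g) xs
  total-concatMap g []       = refl
  total-concatMap g (x ∷ xs) = trans (total-++ (g x) (concatMap g xs)) (cong (total f (g x) +_) (total-concatMap g xs))

total-cong : {A : Set} {f g : A → ℕ} → (∀ x → f x ≡ g x) → ∀ xs → total f xs ≡ total g xs
total-cong f≗g xs = cong sum (map-cong f≗g xs)

weight : List ℕ → ℕ
weight = total suc

replicate-++-∷ : {A : Set} (n : ℕ) (x : A) (xs : List A) → replicate n x ++ x ∷ xs ≡ x ∷ replicate n x ++ xs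
replicate-++-∷ zero    x xs = refl
replicate-++-∷ (suc n) x xs = cong (x ∷_) (replicate-++-∷ n x xs)

module _ {A : Set} where

  lastOf : A → List A → A
  lastOf x []       = x
  lastOf _ (y ∷ ys) = lastOf y ys

  last≡lastOf : ∀ x xs → last (x ∷ xs) ≡ lastOf x xs
  last≡lastOf x []       = refl
  last≡lastOf x (y ∷ ys) with Data.List.initLast ys | last≡lastOf y ys
  ... | Data.List.[]         | e = e
  ... | _ Data.List.∷ʳ′ _    | e = e

  lastOf-All : {P : A → Set} → ∀ x xs → All P (x ∷ xs) → P (lastOf x xs)
  lastOf-All x []       (px ∷ []) = px
  lastOf-All x (y ∷ ys) (_ ∷ pys) = lastOf-All y ys pys

  splitLast : A → List A → List A × A
  splitLast x []       = [] , x
  splitLast x (y ∷ ys) = map₁ (x ∷_) (splitLast y ys)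

  ∷ʳ-splitLast : ∀ x xs → uncurry _∷ʳ_ (splitLast x xs) ≡ x ∷ xs
  ∷ʳ-splitLast x []       = refl
  ∷ʳ-splitLast x (y ∷ ys) = cong (x ∷_) (∷ʳ-splitLast y ys)

  splitLast-∷ʳ : ∀ x xs y → splitLast x (xs ∷ʳ y) ≡ (x ∷ xs , y)
  splitLast-∷ʳ x []       y = refl
  splitLast-∷ʳ x (z ∷ zs) y = cong (map₁ (x ∷_)) (splitLast-∷ʳ z zs y)

withGaps : List ℕ → ℕ → List⁺ ℕ
withGaps []       a = a ∷ []
withGaps (g ∷ gs) a = (g + head (withGaps gs a)) ∷ toList (withGaps gs a)

last-positive : ∀ {p} → IsPartition p → 1 ≤ last p
last-positive {x ∷ xs} (pos , _) = subst (1 ≤_) (sym (last≡lastOf x xs)) (lastOf-All x xs pos)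

≤-head-withGaps : ∀ gs a → a ≤ head (withGaps gs a)
≤-head-withGaps []       a = ≤-refl
≤-head-withGaps (g ∷ gs) a = ≤-trans (≤-head-withGaps gs a) (m≤n+m _ g)

withGaps-isPartition : ∀ gs {a} → 1 ≤ a → IsPartition (withGaps gs a)
withGaps-isPartition []       1≤a = (1≤a ∷ []) , [-]
withGaps-isPartition (g ∷ gs) {a} 1≤a with withGaps-isPartition gs 1≤a
... | pos , dec = (≤-trans 1≤a (≤-trans (≤-head-withGaps gs a) (m≤n+m _ g)) ∷ pos) , (m≤n+m _ g ∷ dec)

gaps-withGaps : ∀ gs a → gaps (withGaps gs a) ≡ gs
gaps-withGaps []       a = refl
gaps-withGaps (g ∷ gs) a = cong₂ _∷_ (m+n∸n≡m g (head (withGaps gs a))) (gaps-withGaps gs a)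

last-withGaps : ∀ gs a → last (withGaps gs a) ≡ a
last-withGaps gs a = trans (last≡lastOf (head (withGaps gs a)) (List⁺.tail (withGaps gs a))) (lastOf-withGaps gs)
  where
  lastOf-withGaps : ∀ gs → lastOf (head (withGaps gs a)) (List⁺.tail (withGaps gs a)) ≡ a
  lastOf-withGaps []       = refl
  lastOf-withGaps (_ ∷ gs) = lastOf-withGaps gs

perimeter-withGaps : ∀ gs a → perimeter (withGaps gs a) ≡ weight gs + a
perimeter-withGaps gs a = cong (_∸ 1) (head+numParts gs)
  where
  head+numParts : ∀ gs → head (withGaps gs a) + numParts (withGaps gs a) ≡ suc (weight gs + a)
  head+numParts []       = +-comm a 1
  head+numParts (g ∷ gs) = begin
      g + h + suc n          ≡⟨ +-suc (g + h) n ⟩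
      suc (g + h + n)        ≡⟨ cong suc (+-assoc g h n) ⟩
      suc (g + (h + n))      ≡⟨ cong (λ x → suc (g + x)) (head+numParts gs) ⟩
      suc (g + suc (weight gs + a)) ≡⟨ cong suc (+-suc g _) ⟩
      suc (suc (g + (weight gs + a))) ≡⟨ cong (suc ∘ suc) (+-assoc g (weight gs) a) ⟨
      suc (suc g + weight gs + a) ∎
    where
    open ≡-Reasoning
    h n : ℕ
    h = head (withGaps gs a)
    n = numParts (withGaps gs a)

withGaps-gaps-last : ∀ {p} → IsPartition p → withGaps (gaps p) (last p) ≡ p
withGaps-gaps-last {x ∷ xs} (_ , dec) = trans (cong (withGaps (gaps (x ∷ xs))) (last≡lastOf x xs)) (go x xs dec)
  where
  go : ∀ x xs → Linked _≥_ (x ∷ xs) → withGaps (gapsL (x ∷ xs)) (lastOf x xs) ≡ x ∷ xs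
  go x []       _           = refl
  go x (y ∷ ys) (y≤x ∷ dec) rewrite go y ys dec = cong (_∷ y ∷ ys) (m∸n+n≡m y≤x)

GapSequence : ℕ → (List ℕ → ℕ → Set) → List ℕ × ℕ → Set
GapSequence n R (gs , a) = (1 ≤ a × weight gs + a ≡ n) × R gs a

module _ {n : ℕ} {P : List⁺ ℕ → Set} {R : List ℕ → ℕ → Set} where

  gapSequences↔perimPartitions : (∀ {p} → IsPartition p → P p ⇔ R (gaps p) (last p)) →
                                 GapSequence n R ↔ˢ (λ p → PerimPartition n p × P p)
  gapSequences↔perimPartitions P⇔R =
    ↔ˢ-byEncoding (uncurry withGaps) (λ p → gaps p , last p)
      (λ (gs , a) → cong₂ _,_ (gaps-withGaps gs a) (last-withGaps gs a))
      (λ ((ip , _) , _) → withGaps-gaps-last ip)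
      gapSequence⇔perimPartition
    where
    gapSequence⇔perimPartition : ∀ x → GapSequence n R x ⇔ (PerimPartition n (uncurry withGaps x) × P (uncurry withGaps x))
    gapSequence⇔perimPartition (gs , a) = mk⇔ to from
      where
      to : GapSequence n R (gs , a) → PerimPartition n (withGaps gs a) × P (withGaps gs a)
      to ((1≤a , w) , r) =
        (ip , trans (perimeter-withGaps gs a) w) ,
        Equivalence.from (P⇔R ip) (subst₂ R (sym (gaps-withGaps gs a)) (sym (last-withGaps gs a)) r)
        where ip = withGaps-isPartition gs 1≤a
      from : PerimPartition n (withGaps gs a) × P (withGaps gs a) → GapSequence n R (gs , a)
      from ((ip , per) , pp) =
        (subst (1 ≤_) (last-withGaps gs a) (last-positive ip) , trans (sym (perimeter-withGaps gs a)) per) ,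
        subst₂ R (gaps-withGaps gs a) (last-withGaps gs a) (Equivalence.to (P⇔R ip) pp)

-- The value on [] is junk.
splitProfile : List ℕ → List ℕ × ℕ
splitProfile []       = [] , 1
splitProfile (x ∷ xs) = map₂ suc (splitLast x xs)

splitProfile-∷ʳ : ∀ gs b → splitProfile (gs ∷ʳ b) ≡ (gs , suc b)
splitProfile-∷ʳ []       b = refl
splitProfile-∷ʳ (g ∷ gs) b = cong (map₂ suc) (splitLast-∷ʳ g gs b)

module _ {n : ℕ} {P : List ℕ → Set} where

  gapSequences↔profiles : 1 ≤ n → GapSequence n (λ gs a → P (gs ∷ʳ (a ∸ 1))) ↔ˢ (λ L → weight L ≡ n × P L)
  gapSequences↔profiles 1≤n = record
    { to      = λ (gs , a) → gs ∷ʳ (a ∸ 1)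
    ; from    = splitProfile
    ; to-∈    = λ { {gs , suc b} ((_ , w) , pL) → trans (total-∷ʳ suc gs b) w , pL }
    ; from-∈  = from-∈
    ; from∘to = λ { {gs , suc b} _ → splitProfile-∷ʳ gs b }
    ; to∘from = λ { {x ∷ xs} _ → ∷ʳ-splitLast x xs ; {[]} (w , _) → contradiction w weight[]≢n }
    }
    where
    weight[]≢n : weight [] ≢ n
    weight[]≢n w = contradiction (subst (1 ≤_) (sym w) 1≤n) λ ()
    from-∈ : ∀ {L} → weight L ≡ n × P L → GapSequence n (λ gs a → P (gs ∷ʳ (a ∸ 1))) (splitProfile L)
    from-∈ {[]}     (w , _)  = contradiction w weight[]≢n
    from-∈ {x ∷ xs} (w , pL) =
      (s≤s z≤n , trans (sym (total-∷ʳ suc gs b)) (trans (cong weight L≡) w)) , subst P (sym L≡) pL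
      where
      gs : List ℕ
      gs = proj₁ (splitLast x xs)
      b : ℕ
      b = proj₂ (splitLast x xs)
      L≡ : gs ∷ʳ b ≡ x ∷ xs
      L≡ = ∷ʳ-splitLast x xs

module _ (m : ℕ) where

  private
    M : ℕ
    M = suc m

  sameClass⇔gap%≡0 : ∀ {x y} → y ≤ x → (x % M ≡ y % M) ⇔ ((x ∸ y) % M ≡ 0)
  sameClass⇔gap%≡0 {x} {y} y≤x =
    subst (λ z → (z % M ≡ y % M) ⇔ ((x ∸ y) % M ≡ 0)) (m∸n+n≡m y≤x) (mk⇔ (⇒ (x ∸ y)) (⇐ (x ∸ y)))
    where
    ⇐ : ∀ b → b % M ≡ 0 → (b + y) % M ≡ y % M
    ⇐ b b%M≡0 = %-remove-+ˡ y (m%n≡0⇒n∣m b M b%M≡0)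
    ⇒ : ∀ b → (b + y) % M ≡ y % M → b % M ≡ 0
    ⇒ b same = n∣m⇒m%n≡0 b M (∣m+n∣m⇒∣n (divides ((b + y) / M) eq) (divides (y / M) refl))
      where
      open ≡-Reasoning
      -- y and b + y have the same remainder, so b is the difference of two multiples of M.
      eq : y / M * M + b ≡ (b + y) / M * M
      eq = +-cancelʳ-≡ (y % M) _ _ (begin
        y / M * M + b + y % M           ≡⟨ cong (_+ y % M) (+-comm (y / M * M) b) ⟩
        b + y / M * M + y % M           ≡⟨ +-assoc b _ _ ⟩
        b + (y / M * M + y % M)         ≡⟨ cong (b +_) (+-comm (y / M * M) (y % M)) ⟩
        b + (y % M + y / M * M)         ≡⟨ cong (b +_) (m≡m%n+[m/n]*n y M) ⟨
        b + y                           ≡⟨ m≡m%n+[m/n]*n (b + y) M ⟩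
        (b + y) % M + (b + y) / M * M   ≡⟨ cong (_+ (b + y) / M * M) same ⟩
        y % M + (b + y) / M * M         ≡⟨ +-comm (y % M) _ ⟩
        (b + y) / M * M + y % M         ∎)

  Admissible : ℕ → Set
  Admissible b = b % M ≡ 0 ⊎ m < b

  Compatible : ℕ → ℕ → Set
  Compatible x y = x % M ≡ y % M ⊎ (x % M ≢ y % M × m < x ∸ y)

  compatible⇔admissible : ∀ {x y} → y ≤ x → Compatible x y ⇔ Admissible (x ∸ y)
  compatible⇔admissible {x} {y} y≤x = mk⇔ to from
    where
    open Equivalence (sameClass⇔gap%≡0 y≤x) renaming (to to same⇒; from to ⇒same)
    to : Compatible x y → Admissible (x ∸ y)
    to (inj₁ same)     = inj₁ (same⇒ same)
    to (inj₂ (_ , far)) = inj₂ far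
    from : Admissible (x ∸ y) → Compatible x y
    from (inj₁ divisible) = inj₁ (⇒same divisible)
    from (inj₂ far) with x % M ≟ y % M
    ... | yes same = inj₁ same
    ... | no  diff = inj₂ (diff , far)

  classChange : ℕ → ℕ → ℕ
  classChange x y = χ¬ (x % M ≟ y % M)

  classChanges : List ℕ → ℕ
  classChanges (x ∷ y ∷ r) = classChange x y + classChanges (y ∷ r)
  classChanges _           = 0

  nonMultiple : ℕ → ℕ
  nonMultiple b = χ¬ (b % M ≟ 0)

  classChange≡nonMultiple : ∀ {x y} → y ≤ x → classChange x y ≡ nonMultiple (x ∸ y)
  classChange≡nonMultiple {x} {y} y≤x = χ¬-cong (sameClass⇔gap%≡0 y≤x) (x % M ≟ y % M) ((x ∸ y) % M ≟ 0)

  linked-compatible⇔ : ∀ {xs} → Linked _≥_ xs → Linked Compatible xs ⇔ All Admissible (gapsL xs)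
  linked-compatible⇔ []  = mk⇔ (λ _ → []) (λ _ → [])
  linked-compatible⇔ [-] = mk⇔ (λ _ → []) (λ _ → [-])
  linked-compatible⇔ {x ∷ y ∷ _} (y≤x ∷ dec) = mk⇔
    (λ { (c ∷ cs) → Equivalence.to (compatible⇔admissible y≤x) c ∷ Equivalence.to (linked-compatible⇔ dec) cs })
    (λ { (a ∷ as) → Equivalence.from (compatible⇔admissible y≤x) a ∷ Equivalence.from (linked-compatible⇔ dec) as })

  classChanges≡ : ∀ {xs} → Linked _≥_ xs → classChanges xs ≡ total nonMultiple (gapsL xs)
  classChanges≡ []          = refl
  classChanges≡ [-]         = refl
  classChanges≡ (y≤x ∷ dec) = cong₂ _+_ (classChange≡nonMultiple y≤x) (classChanges≡ dec)

  LastOK : ℕ → Set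
  LastOK a = a % M ≡ 1 % M ⊎ (a % M ≢ 1 % M × M < a)

  lastOK⇔ : ∀ {a} → 1 ≤ a → LastOK a ⇔ Admissible (a ∸ 1)
  lastOK⇔ {suc b} 1≤a = mk⇔ (Equivalence.to compatible ∘ to) (from ∘ Equivalence.from compatible)
    where
    compatible : Compatible (suc b) 1 ⇔ Admissible b
    compatible = compatible⇔admissible 1≤a
    to : LastOK (suc b) → Compatible (suc b) 1
    to (inj₁ same)         = inj₁ same
    to (inj₂ (diff , big)) = inj₂ (diff , ≤-pred big)
    from : Compatible (suc b) 1 → LastOK (suc b)
    from (inj₁ same)         = inj₁ same
    from (inj₂ (diff , far)) = inj₂ (diff , s≤s far)

  block-linked : ∀ x xs → All (λ z → z % M ≡ x % M) (x ∷ xs) →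
                 Linked Compatible (x ∷ xs) × classChanges (x ∷ xs) ≡ 0
  block-linked x []       _                  = [-] , refl
  block-linked x (y ∷ ys) (_ ∷ y≡x ∷ same) =
    (inj₁ (sym y≡x) ∷ proj₁ ih) , cong₂ _+_ (χ¬-yes (x % M ≟ y % M) (sym y≡x)) (proj₂ ih)
    where ih = block-linked y ys (All.map (λ z≡x → trans z≡x (sym y≡x)) (y≡x ∷ same))

  block-++-linked : ∀ x xs y ys → All (λ z → z % M ≡ x % M) (x ∷ xs) →
                    lastOf x xs % M ≢ y % M → m < lastOf x xs ∸ y → Linked Compatible (y ∷ ys) →
                    Linked Compatible (x ∷ xs ++ y ∷ ys) × classChanges (x ∷ xs ++ y ∷ ys) ≡ suc (classChanges (y ∷ ys))
  block-++-linked x [] y ys _ diff far lk =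
    (inj₂ (diff , far) ∷ lk) , cong (_+ classChanges (y ∷ ys)) (χ¬-no (x % M ≟ y % M) diff)
  block-++-linked x (x′ ∷ xs) y ys (_ ∷ x′≡x ∷ same) diff far lk =
    (inj₁ (sym x′≡x) ∷ proj₁ ih) , trans (cong (_+ _) (χ¬-yes (x % M ≟ x′ % M) (sym x′≡x))) (proj₂ ih)
    where ih = block-++-linked x′ xs y ys (All.map (λ z≡x → trans z≡x (sym x′≡x)) (x′≡x ∷ same)) diff far lk

  grouping⇒linked : ∀ b bs → All (SameClass m) (b ∷ bs) → Linked (NeighbourOK m) (b ∷ bs) →
                    let xs = concat (map toList (b ∷ bs)) in Linked Compatible xs × length bs ≡ classChanges xs
  grouping⇒linked (x ∷ xs) [] (same ∷ []) _ rewrite ++-identityʳ xs = map₂ sym (block-linked x xs same)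
  grouping⇒linked (x ∷ xs) ((y ∷ ys) ∷ bs) (same ∷ sames) ((diff , far) ∷ nbs) =
    proj₁ joined , trans (cong suc (proj₂ rest)) (sym (proj₂ joined))
    where
    rest   = grouping⇒linked (y ∷ ys) bs sames nbs
    joined = block-++-linked x xs y (ys ++ concat (map toList bs)) same
               (subst (λ l → l % M ≢ y % M) (last≡lastOf x xs) diff)
               (subst (λ l → m < l ∸ y) (last≡lastOf x xs) far) (proj₁ rest)

  relink : ∀ {b b′} bs → last b ≡ last b′ → Linked (NeighbourOK m) (b′ ∷ bs) → Linked (NeighbourOK m) (b ∷ bs)
  relink []      _  _         = [-]
  relink (c ∷ _) eq (nb ∷ nbs) = subst (λ l → (l % M ≢ head c % M) × (m < l ∸ head c)) (sym eq) nb ∷ nbs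

  linked⇒grouping : ∀ x xs → Linked Compatible (x ∷ xs) →
                    Σ (List⁺ ℕ) λ b → Σ (List (List⁺ ℕ)) λ bs →
                      head b ≡ x × IsGrouping m (x ∷ xs) (b ∷ bs) × length bs ≡ classChanges (x ∷ xs)
  linked⇒grouping x [] _ = (x ∷ []) , [] , refl , (refl , (refl ∷ []) ∷ [] , [-]) , refl
  linked⇒grouping x (y ∷ ys) (compatible ∷ lk) with linked⇒grouping y ys lk | x % M ≟ y % M
  ... | (y ∷ t) , bs , refl , (conc , same ∷ sames , nbs) , len | yes x≡y =
    (x ∷ y ∷ t) , bs , refl ,
    (cong (x ∷_) conc , (refl ∷ All.map (λ z≡y → trans z≡y (sym x≡y)) same) ∷ sames ,
     relink bs (trans (last≡lastOf x (y ∷ t)) (sym (last≡lastOf y t))) nbs) ,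
    trans len (cong (_+ classChanges (y ∷ ys)) (sym (χ¬-yes (x % M ≟ y % M) x≡y)))
  ... | (y ∷ t) , bs , refl , (conc , sames , nbs) , len | no x≢y with compatible
  ...   | inj₁ x≡y         = contradiction x≡y x≢y
  ...   | inj₂ (diff , far) =
    (x ∷ []) , (y ∷ t) ∷ bs , refl , (cong (x ∷_) conc , (refl ∷ []) ∷ sames , (diff , far) ∷ nbs) ,
    trans (cong suc len) (cong (_+ classChanges (y ∷ ys)) (sym (χ¬-no (x % M ≟ y % M) x≢y)))

  family1⇔linked : ∀ {k p} → Family1 m k p ⇔
                   (Linked Compatible (toList p) × LastOK (last p) × k ≡ classChanges (toList p) + classChange (last p) 1)
  family1⇔linked {k} {p} = mk⇔ to from
    where
    a : ℕ
    a = last p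
    d : Dec (a % M ≡ 1 % M)
    d = a % M ≟ 1 % M
    BlockCount : ℕ → Set
    BlockCount blocks = (a % M ≡ 1 % M × blocks ≡ suc k) ⊎ (a % M ≢ 1 % M × blocks ≡ k × M < a)
    to : Family1 m k p → Linked Compatible (toList p) × LastOK a × k ≡ classChanges (toList p) + χ¬ d
    to ([] , (() , _) , _)
    to (b ∷ bs , (conc , sames , nbs) , blocks) = subst (Linked Compatible) conc (proj₁ linked) , lastOK blocks , count blocks
      where
      linked = grouping⇒linked b bs sames nbs
      len : length bs ≡ classChanges (toList p)
      len = trans (proj₂ linked) (cong classChanges conc)
      lastOK : BlockCount (suc (length bs)) → LastOK a
      lastOK (inj₁ (same , _))       = inj₁ same
      lastOK (inj₂ (diff , _ , big)) = inj₂ (diff , big)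
      count : BlockCount (suc (length bs)) → k ≡ classChanges (toList p) + χ¬ d
      count (inj₁ (same , len≡))    = trans (suc-injective (trans (sym len≡) (cong suc len))) (sym (+χ¬-yes _ d same))
      count (inj₂ (diff , len≡ , _)) = trans (sym len≡) (trans (cong suc len) (sym (+χ¬-no _ d diff)))
    from : Linked Compatible (toList p) × LastOK a × k ≡ classChanges (toList p) + χ¬ d → Family1 m k p
    from (lk , lastOK , k≡) with linked⇒grouping (head p) (List⁺.tail p) lk
    ... | b , bs , _ , grouping , len = (b ∷ bs) , grouping , blocks lastOK
      where
      blocks : LastOK a → BlockCount (suc (length bs))
      blocks (inj₁ same)         = inj₁ (same , cong suc (trans len (sym (trans k≡ (+χ¬-yes _ d same)))))
      blocks (inj₂ (diff , big)) = inj₂ (diff , trans (cong suc len) (sym (trans k≡ (+χ¬-no _ d diff))) , big)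

  AdmissibleProfile : ℕ → List ℕ → Set
  AdmissibleProfile k L = All Admissible L × total nonMultiple L ≡ k

  family1⇔admissibleProfile : ∀ {k p} → IsPartition p → Family1 m k p ⇔ AdmissibleProfile k (gaps p ∷ʳ (last p ∸ 1))
  family1⇔admissibleProfile {k} {p} ip@(_ , dec) = mk⇔ to from
    where
    a : ℕ
    a = last p
    1≤a : 1 ≤ a
    1≤a = last-positive ip
    count : total nonMultiple (gaps p ∷ʳ (a ∸ 1)) ≡ classChanges (toList p) + classChange a 1
    count = trans (total-∷ʳ nonMultiple (gaps p) (a ∸ 1))
                  (sym (cong₂ _+_ (classChanges≡ dec) (classChange≡nonMultiple 1≤a)))
    to : Family1 m k p → AdmissibleProfile k (gaps p ∷ʳ (a ∸ 1))
    to f1 =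
      let lk , lastOK , k≡ = Equivalence.to (family1⇔linked {k} {p}) f1
      in ∷ʳ⁺ (Equivalence.to (linked-compatible⇔ dec) lk) (Equivalence.to (lastOK⇔ 1≤a) lastOK) , trans count (sym k≡)
    from : AdmissibleProfile k (gaps p ∷ʳ (a ∸ 1)) → Family1 m k p
    from (admissible , count≡k) = Equivalence.from (family1⇔linked {k} {p})
      (Equivalence.from (linked-compatible⇔ dec) (proj₁ (∷ʳ⁻ admissible)) ,
       Equivalence.from (lastOK⇔ 1≤a) (proj₂ (∷ʳ⁻ admissible)) ,
       trans (sym count≡k) count)

  data Letter : Set where
    one full : Letter
    part     : ℕ → Letter

  Word : Set
  Word = List Letter

  letterWeight : Letter → ℕ
  letterWeight one      = 1
  letterWeight full     = M
  letterWeight (part r) = r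

  isPart : Letter → ℕ
  isPart (part _) = 1
  isPart one      = 0
  isPart full     = 0

  data State : Set where
    start afterFull afterPart : State

  data Accepts : State → Word → Set where
    []    : Accepts start []
    one∷  : ∀ {s w} → Accepts start w → Accepts s (one ∷ w)
    full∷ : ∀ {w} → Accepts afterFull w → Accepts start (full ∷ w)
    full∷full∷ : ∀ {w} → Accepts afterFull w → Accepts afterFull (full ∷ w)
    part∷ : ∀ {r w} → 1 ≤ r → r ≤ m → Accepts afterPart w → Accepts afterFull (part r ∷ w)

  residue : ℕ → Word
  residue zero    = one ∷ []
  residue (suc r) = part (suc r) ∷ one ∷ []

  encodeEntry : ℕ → Word
  encodeEntry b = replicate (b / M) full ++ residue (b % M)

  encode₁ : List ℕ → Word
  encode₁ = concatMap encodeEntry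

  -- j counts the fulls read since the last entry; the last clause is junk
  -- (it is never reached on accepted words).
  decode₁ : ℕ → Word → List ℕ
  decode₁ j []                 = []
  decode₁ j (full ∷ w)         = decode₁ (suc j) w
  decode₁ j (one ∷ w)          = j * M ∷ decode₁ 0 w
  decode₁ j (part r ∷ one ∷ w) = r + j * M ∷ decode₁ 0 w
  decode₁ j (part r ∷ _)       = []

  decode₁-fulls : ∀ i j w → decode₁ j (replicate i full ++ w) ≡ decode₁ (i + j) w
  decode₁-fulls zero    j w = refl
  decode₁-fulls (suc i) j w = trans (decode₁-fulls i (suc j) w) (cong (λ x → decode₁ x w) (+-suc i j))

  decode₁-residue : ∀ j r w → decode₁ j (residue r ++ w) ≡ r + j * M ∷ decode₁ 0 w
  decode₁-residue j zero    w = refl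
  decode₁-residue j (suc r) w = refl

  decode₁-encodeEntry : ∀ b w → decode₁ 0 (encodeEntry b ++ w) ≡ b ∷ decode₁ 0 w
  decode₁-encodeEntry b w = begin
    decode₁ 0 ((replicate (b / M) full ++ residue (b % M)) ++ w) ≡⟨ cong (decode₁ 0) (++-assoc (replicate (b / M) full) _ w) ⟩
    decode₁ 0 (replicate (b / M) full ++ residue (b % M) ++ w)   ≡⟨ decode₁-fulls (b / M) 0 _ ⟩
    decode₁ (b / M + 0) (residue (b % M) ++ w)                   ≡⟨ decode₁-residue (b / M + 0) (b % M) w ⟩
    b % M + (b / M + 0) * M ∷ decode₁ 0 w                        ≡⟨ cong (λ q → b % M + q * M ∷ decode₁ 0 w) (+-identityʳ (b / M)) ⟩
    b % M + b / M * M ∷ decode₁ 0 w                              ≡⟨ cong (_∷ decode₁ 0 w) (m≡m%n+[m/n]*n b M) ⟨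
    b ∷ decode₁ 0 w                                              ∎
    where open ≡-Reasoning

  decode₁-encode₁ : ∀ L → decode₁ 0 (encode₁ L) ≡ L
  decode₁-encode₁ []      = refl
  decode₁-encode₁ (b ∷ L) = trans (decode₁-encodeEntry b (encode₁ L)) (cong (b ∷_) (decode₁-encode₁ L))

  encodeEntry-divMod : ∀ j r → r < M → encodeEntry (r + j * M) ≡ replicate j full ++ residue r
  encodeEntry-divMod j r r<M = cong₂ (λ q s → replicate q full ++ residue s) quotient remainder
    where
    remainder : (r + j * M) % M ≡ r
    remainder = trans ([m+kn]%n≡m%n r j M) (m<n⇒m%n≡m r<M)
    quotient : (r + j * M) / M ≡ j
    quotient = trans (+-distrib-/-∣ʳ r (divides j refl)) (cong₂ _+_ (m<n⇒m/n≡0 r<M) (m*n/n≡m j M))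

  encode₁-decode₁ : ∀ {s w} j → Accepts s w → (s ≡ start → j ≡ 0) → encode₁ (decode₁ j w) ≡ replicate j full ++ w
  encode₁-decode₁ j [] j≡0 rewrite j≡0 refl = refl
  encode₁-decode₁ {w = one ∷ w} j (one∷ acc) _ = begin
    encodeEntry (j * M) ++ encode₁ (decode₁ 0 w)
      ≡⟨ cong₂ _++_ (encodeEntry-divMod j 0 (s≤s z≤n)) (encode₁-decode₁ 0 acc (λ _ → refl)) ⟩
    (replicate j full ++ residue 0) ++ w
      ≡⟨ ++-assoc (replicate j full) (residue 0) w ⟩
    replicate j full ++ one ∷ w ∎
    where open ≡-Reasoning
  encode₁-decode₁ {w = full ∷ w} j (full∷ acc) _ =
    trans (encode₁-decode₁ (suc j) acc (λ ())) (sym (replicate-++-∷ j full w))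
  encode₁-decode₁ {w = full ∷ w} j (full∷full∷ acc) _ =
    trans (encode₁-decode₁ (suc j) acc (λ ())) (sym (replicate-++-∷ j full w))
  encode₁-decode₁ {w = part (suc r) ∷ one ∷ w} j (part∷ _ r<m (one∷ acc)) _ = begin
    encodeEntry (suc r + j * M) ++ encode₁ (decode₁ 0 w)
      ≡⟨ cong₂ _++_ (encodeEntry-divMod j (suc r) (s≤s r<m)) (encode₁-decode₁ 0 acc (λ _ → refl)) ⟩
    (replicate j full ++ residue (suc r)) ++ w
      ≡⟨ ++-assoc (replicate j full) (residue (suc r)) w ⟩
    replicate j full ++ part (suc r) ∷ one ∷ w ∎
    where open ≡-Reasoning

  fulls-accepted : ∀ j {w} → Accepts afterFull w → Accepts afterFull (replicate j full ++ w)
  fulls-accepted zero    acc = acc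
  fulls-accepted (suc j) acc = full∷full∷ (fulls-accepted j acc)

  fulls-residue-accepted : ∀ j r {w} → r ≡ 0 ⊎ 1 ≤ j → r < M → Accepts start w →
                           Accepts start (replicate j full ++ residue r ++ w)
  fulls-residue-accepted zero    zero    _          _         acc = one∷ acc
  fulls-residue-accepted (suc j) zero    _          _         acc = full∷ (fulls-accepted j (one∷ acc))
  fulls-residue-accepted zero    (suc r) (inj₂ ())  _         _
  fulls-residue-accepted (suc j) (suc r) _          (s≤s r<m) acc =
    full∷ (fulls-accepted j (part∷ (s≤s z≤n) r<m (one∷ acc)))

  fulls-residue-accepted⁻ : ∀ j r {s w} → Accepts s (replicate j full ++ residue r ++ w) → Accepts start w
  fulls-residue-accepted⁻ zero    zero    (one∷ acc)              = acc
  fulls-residue-accepted⁻ zero    (suc r) (part∷ _ _ (one∷ acc)) = acc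
  fulls-residue-accepted⁻ (suc j) r       (full∷ acc)             = fulls-residue-accepted⁻ j r acc
  fulls-residue-accepted⁻ (suc j) r       (full∷full∷ acc)        = fulls-residue-accepted⁻ j r acc

  fulls-residue-shape : ∀ j r {w} → Accepts start (replicate j full ++ residue r ++ w) → r ≡ 0 ⊎ 1 ≤ j
  fulls-residue-shape zero    zero    _ = inj₁ refl
  fulls-residue-shape (suc j) _       _ = inj₂ (s≤s z≤n)

  admissible⇔ : ∀ b → Admissible b ⇔ (b % M ≡ 0 ⊎ 1 ≤ b / M)
  admissible⇔ b = mk⇔ to from
    where
    to : Admissible b → b % M ≡ 0 ⊎ 1 ≤ b / M
    to (inj₁ divisible) = inj₁ divisible
    to (inj₂ m<b)       = inj₂ (m≥n⇒m/n>0 m<b)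
    from : b % M ≡ 0 ⊎ 1 ≤ b / M → Admissible b
    from (inj₁ divisible) = inj₁ divisible
    from (inj₂ 1≤b/M)     = inj₂ (m/n≢0⇒n≤m (λ b/M≡0 → contradiction (subst (1 ≤_) b/M≡0 1≤b/M) λ ()))

  encode₁-accepted⇔ : ∀ L → All Admissible L ⇔ Accepts start (encode₁ L)
  encode₁-accepted⇔ []      = mk⇔ (λ _ → []) (λ _ → [])
  encode₁-accepted⇔ (b ∷ L) = mk⇔
    (λ { (adm ∷ adms) → subst (Accepts start) (sym assoc)
          (fulls-residue-accepted (b / M) (b % M) (Equivalence.to (admissible⇔ b) adm) (m%n<n b M)
            (Equivalence.to (encode₁-accepted⇔ L) adms)) })
    (λ acc → let acc′ = subst (Accepts start) assoc acc in
       Equivalence.from (admissible⇔ b) (fulls-residue-shape (b / M) (b % M) acc′) ∷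
       Equivalence.from (encode₁-accepted⇔ L) (fulls-residue-accepted⁻ (b / M) (b % M) acc′))
    where
    assoc = ++-assoc (replicate (b / M) full) (residue (b % M)) (encode₁ L)

  wordWeight : Word → ℕ
  wordWeight = total letterWeight

  #parts : Word → ℕ
  #parts = total isPart

  wordWeight-encodeEntry : ∀ b → wordWeight (encodeEntry b) ≡ suc b
  wordWeight-encodeEntry b = begin
    wordWeight (replicate (b / M) full ++ residue (b % M))
      ≡⟨ total-++ letterWeight (replicate (b / M) full) (residue (b % M)) ⟩
    wordWeight (replicate (b / M) full) + wordWeight (residue (b % M))
      ≡⟨ cong₂ _+_ (total-replicate letterWeight (b / M) full) (residue-weight (b % M)) ⟩
    b / M * M + suc (b % M)
      ≡⟨ +-suc _ _ ⟩
    suc (b / M * M + b % M)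
      ≡⟨ cong suc (+-comm (b / M * M) (b % M)) ⟩
    suc (b % M + b / M * M)
      ≡⟨ cong suc (m≡m%n+[m/n]*n b M) ⟨
    suc b ∎
    where
    open ≡-Reasoning
    residue-weight : ∀ r → wordWeight (residue r) ≡ suc r
    residue-weight zero    = refl
    residue-weight (suc r) = cong suc (+-comm r 1)

  #parts-encodeEntry : ∀ b → #parts (encodeEntry b) ≡ nonMultiple b
  #parts-encodeEntry b = begin
    #parts (replicate (b / M) full ++ residue (b % M))
      ≡⟨ total-++ isPart (replicate (b / M) full) (residue (b % M)) ⟩
    #parts (replicate (b / M) full) + #parts (residue (b % M))
      ≡⟨ cong (_+ #parts (residue (b % M))) (trans (total-replicate isPart (b / M) full) (*-zeroʳ (b / M))) ⟩
    #parts (residue (b % M))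
      ≡⟨ residue-parts (b % M) ⟩
    nonMultiple b ∎
    where
    open ≡-Reasoning
    residue-parts : ∀ r → #parts (residue r) ≡ χ¬ (r ≟ 0)
    residue-parts zero    = refl
    residue-parts (suc r) = refl

  wordWeight-encode₁ : ∀ L → wordWeight (encode₁ L) ≡ weight L
  wordWeight-encode₁ L = trans (total-concatMap letterWeight encodeEntry L) (total-cong wordWeight-encodeEntry L)

  #parts-encode₁ : ∀ L → #parts (encode₁ L) ≡ total nonMultiple L
  #parts-encode₁ L = trans (total-concatMap isPart encodeEntry L) (total-cong #parts-encodeEntry L)

  encodeGap : ℕ → Word
  encodeGap g with m ≤? g
  ... | yes _ = replicate (g ∸ m) one ++ full ∷ []
  ... | no  _ = part (suc g) ∷ []

  encode₂ : List ℕ → ℕ → Word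
  encode₂ []       a = replicate a one
  encode₂ (g ∷ gs) a = encodeGap g ++ encode₂ gs a

  -- c counts the ones read since the last gap.
  decode₂ : ℕ → Word → List ℕ × ℕ
  decode₂ c []           = [] , c
  decode₂ c (one ∷ w)    = decode₂ (suc c) w
  decode₂ c (full ∷ w)   = map₁ (c + m ∷_) (decode₂ 0 w)
  decode₂ c (part r ∷ w) = map₁ (r ∸ 1 ∷_) (decode₂ 0 w)

  encodeGap-≥ : ∀ {g} → m ≤ g → encodeGap g ≡ replicate (g ∸ m) one ++ full ∷ []
  encodeGap-≥ {g} m≤g with m ≤? g
  ... | yes _   = refl
  ... | no  m≰g = contradiction m≤g m≰g

  encodeGap-< : ∀ {g} → g < m → encodeGap g ≡ part (suc g) ∷ []
  encodeGap-< {g} g<m with m ≤? g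
  ... | yes m≤g = contradiction m≤g (<⇒≱ g<m)
  ... | no  _   = refl

  encodeGap-large-++ : ∀ {g} → m ≤ g → ∀ w → encodeGap g ++ w ≡ replicate (g ∸ m) one ++ full ∷ w
  encodeGap-large-++ {g} m≤g w =
    trans (cong (_++ w) (encodeGap-≥ m≤g)) (++-assoc (replicate (g ∸ m) one) (full ∷ []) w)

  encodeGap-+m-++ : ∀ c w → encodeGap (c + m) ++ w ≡ replicate c one ++ full ∷ w
  encodeGap-+m-++ c w =
    trans (encodeGap-large-++ (m≤n+m m c) w) (cong (λ x → replicate x one ++ full ∷ w) (m+n∸n≡m c m))

  decode₂-ones : ∀ i c w → decode₂ c (replicate i one ++ w) ≡ decode₂ (i + c) w
  decode₂-ones zero    c w = refl
  decode₂-ones (suc i) c w = trans (decode₂-ones i (suc c) w) (cong (λ x → decode₂ x w) (+-suc i c))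

  decode₂-encodeGap : ∀ g w → decode₂ 0 (encodeGap g ++ w) ≡ map₁ (g ∷_) (decode₂ 0 w)
  decode₂-encodeGap g w with m ≤? g
  ... | no  _   = refl
  ... | yes m≤g = begin
    decode₂ 0 ((replicate (g ∸ m) one ++ full ∷ []) ++ w) ≡⟨ cong (decode₂ 0) (++-assoc (replicate (g ∸ m) one) _ w) ⟩
    decode₂ 0 (replicate (g ∸ m) one ++ full ∷ w)         ≡⟨ decode₂-ones (g ∸ m) 0 (full ∷ w) ⟩
    map₁ (g ∸ m + 0 + m ∷_) (decode₂ 0 w)         ≡⟨ cong (λ x → map₁ (x + m ∷_) (decode₂ 0 w)) (+-identityʳ (g ∸ m)) ⟩
    map₁ (g ∸ m + m ∷_) (decode₂ 0 w)             ≡⟨ cong (λ x → map₁ (x ∷_) (decode₂ 0 w)) (m∸n+n≡m m≤g) ⟩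
    map₁ (g ∷_) (decode₂ 0 w)                     ∎
    where open ≡-Reasoning

  decode₂-encode₂ : ∀ gs a → decode₂ 0 (encode₂ gs a) ≡ (gs , a)
  decode₂-encode₂ []       a = trans (cong (decode₂ 0) (sym (++-identityʳ (replicate a one))))
                                     (trans (decode₂-ones a 0 []) (cong ([] ,_) (+-identityʳ a)))
  decode₂-encode₂ (g ∷ gs) a = trans (decode₂-encodeGap g (encode₂ gs a)) (cong (map₁ (g ∷_)) (decode₂-encode₂ gs a))

  encode₂-decode₂ : ∀ {s w} c → Accepts s w → (s ≡ afterFull → c ≡ 0) →
                    uncurry encode₂ (decode₂ c w) ≡ replicate c one ++ w
  encode₂-decode₂ c [] _ = sym (++-identityʳ (replicate c one))
  encode₂-decode₂ {w = one ∷ w} c (one∷ acc) _ =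
    trans (encode₂-decode₂ (suc c) acc (λ ())) (sym (replicate-++-∷ c one w))
  encode₂-decode₂ {w = full ∷ w} c (full∷ acc) _ =
    trans (cong (encodeGap (c + m) ++_) (encode₂-decode₂ 0 acc (λ _ → refl))) (encodeGap-+m-++ c w)
  encode₂-decode₂ {w = full ∷ w} c (full∷full∷ acc) _ =
    trans (cong (encodeGap (c + m) ++_) (encode₂-decode₂ 0 acc (λ _ → refl))) (encodeGap-+m-++ c w)
  encode₂-decode₂ {w = part (suc r) ∷ w} c (part∷ _ r<m acc) c≡0 rewrite c≡0 refl =
    cong₂ _++_ (encodeGap-< r<m) (encode₂-decode₂ 0 acc (λ ()))

  data Isolated : State → List ℕ → Set where
    []     : ∀ {s} → Isolated s []
    large∷ : ∀ {s g gs} → m ≤ g → (s ≡ afterPart → m < g) → Isolated afterFull gs → Isolated s (g ∷ gs)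
    small∷ : ∀ {g gs} → g < m → Isolated afterPart gs → Isolated afterFull (g ∷ gs)

  ones-accepted : ∀ a → Accepts start (replicate a one)
  ones-accepted zero    = []
  ones-accepted (suc a) = one∷ (ones-accepted a)

  ones-full-accepted : ∀ s c {w} → (s ≡ afterPart → 1 ≤ c) → Accepts afterFull w → Accepts s (replicate c one ++ full ∷ w)
  ones-full-accepted start     zero    _   acc = full∷ acc
  ones-full-accepted afterFull zero    _   acc = full∷full∷ acc
  ones-full-accepted afterPart zero    1≤c _   = contradiction (1≤c refl) λ ()
  ones-full-accepted s         (suc c) _   acc = one∷ (ones-full-accepted start c (λ ()) acc)

  ones-full-accepted⁻ : ∀ s c {w} → Accepts s (replicate c one ++ full ∷ w) → (s ≡ afterPart → 1 ≤ c) × Accepts afterFull w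
  ones-full-accepted⁻ start     zero    (full∷ acc)      = (λ ()) , acc
  ones-full-accepted⁻ afterFull zero    (full∷full∷ acc) = (λ ()) , acc
  ones-full-accepted⁻ s         (suc c) (one∷ acc)       = (λ _ → s≤s z≤n) , proj₂ (ones-full-accepted⁻ start c acc)

  encode₂-accepted : ∀ {s gs} a → Isolated s gs → 1 ≤ a → Accepts s (encode₂ gs a)
  encode₂-accepted (suc a) [] _ = one∷ (ones-accepted a)
  encode₂-accepted {s} {g ∷ gs} a (large∷ m≤g far iso) 1≤a =
    subst (Accepts s) (sym (encodeGap-large-++ m≤g (encode₂ gs a)))
      (ones-full-accepted s (g ∸ m) (λ s≡ → m<n⇒0<n∸m (far s≡)) (encode₂-accepted a iso 1≤a))
  encode₂-accepted {gs = g ∷ gs} a (small∷ g<m iso) 1≤a =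
    subst (Accepts afterFull) (cong (_++ encode₂ gs a) (sym (encodeGap-< g<m)))
      (part∷ (s≤s z≤n) g<m (encode₂-accepted a iso 1≤a))

  encode₂-accepted⁻ : ∀ {s} gs a → Accepts s (encode₂ gs a) → Isolated s gs
  encode₂-accepted⁻ []       a _ = []
  encode₂-accepted⁻ {s} (g ∷ gs) a acc with m ≤? g
  ... | yes m≤g =
    let pos , acc′ = ones-full-accepted⁻ s (g ∸ m) (subst (Accepts s) (++-assoc (replicate (g ∸ m) one) _ _) acc)
    in large∷ m≤g (λ s≡ → m∸n≢0⇒n<m (λ g∸m≡0 → contradiction (subst (1 ≤_) g∸m≡0 (pos s≡)) λ ()))
         (encode₂-accepted⁻ gs a acc′)
  encode₂-accepted⁻ (g ∷ gs) a (part∷ _ _ acc′) | no m≰g = small∷ (≰⇒> m≰g) (encode₂-accepted⁻ gs a acc′)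

  encode₂-zero-accepted : ∀ {s} gs → Accepts s (encode₂ gs 0) → s ≡ start × gs ≡ []
  encode₂-zero-accepted []       [] = refl , refl
  encode₂-zero-accepted {s} (g ∷ gs) acc with m ≤? g
  ... | yes m≤g with encode₂-zero-accepted gs
         (proj₂ (ones-full-accepted⁻ s (g ∸ m) (subst (Accepts s) (++-assoc (replicate (g ∸ m) one) _ _) acc)))
  ...   | () , _
  encode₂-zero-accepted (g ∷ gs) (part∷ _ _ acc′) | no _ with encode₂-zero-accepted gs acc′
  ...   | () , _

  wordWeight-encodeGap : ∀ g → wordWeight (encodeGap g) ≡ suc g
  wordWeight-encodeGap g with m ≤? g
  ... | no  _   = +-identityʳ (suc g)
  ... | yes m≤g = begin
    wordWeight (replicate (g ∸ m) one ++ full ∷ [])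
      ≡⟨ total-++ letterWeight (replicate (g ∸ m) one) (full ∷ []) ⟩
    wordWeight (replicate (g ∸ m) one) + (M + 0)
      ≡⟨ cong₂ _+_ (trans (total-replicate letterWeight (g ∸ m) one) (*-identityʳ (g ∸ m))) (+-identityʳ M) ⟩
    g ∸ m + suc m
      ≡⟨ +-suc (g ∸ m) m ⟩
    suc (g ∸ m + m)
      ≡⟨ cong suc (m∸n+n≡m m≤g) ⟩
    suc g ∎
    where open ≡-Reasoning

  wordWeight-encode₂ : ∀ gs a → wordWeight (encode₂ gs a) ≡ weight gs + a
  wordWeight-encode₂ []       a = trans (total-replicate letterWeight a one) (*-identityʳ a)
  wordWeight-encode₂ (g ∷ gs) a = begin
    wordWeight (encodeGap g ++ encode₂ gs a)          ≡⟨ total-++ letterWeight (encodeGap g) (encode₂ gs a) ⟩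
    wordWeight (encodeGap g) + wordWeight (encode₂ gs a) ≡⟨ cong₂ _+_ (wordWeight-encodeGap g) (wordWeight-encode₂ gs a) ⟩
    suc g + (weight gs + a)                            ≡⟨ +-assoc (suc g) (weight gs) a ⟨
    suc g + weight gs + a                              ∎
    where open ≡-Reasoning

  #parts-encode₂ : ∀ gs a → #parts (encode₂ gs a) ≡ length (filter (_<? m) gs)
  #parts-encode₂ []       a = trans (total-replicate isPart a one) (*-zeroʳ a)
  #parts-encode₂ (g ∷ gs) a with m ≤? g
  ... | yes m≤g = begin
    #parts ((replicate (g ∸ m) one ++ full ∷ []) ++ encode₂ gs a)
      ≡⟨ total-++ isPart (replicate (g ∸ m) one ++ full ∷ []) (encode₂ gs a) ⟩
    #parts (replicate (g ∸ m) one ++ full ∷ []) + #parts (encode₂ gs a)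
      ≡⟨ cong₂ _+_ ones-full-parts (#parts-encode₂ gs a) ⟩
    length (filter (_<? m) gs)
      ≡⟨ cong length (filter-reject (_<? m) (λ g<m → <⇒≱ g<m m≤g)) ⟨
    length (filter (_<? m) (g ∷ gs)) ∎
    where
    open ≡-Reasoning
    ones-full-parts : #parts (replicate (g ∸ m) one ++ full ∷ []) ≡ 0
    ones-full-parts = trans (total-++ isPart (replicate (g ∸ m) one) (full ∷ []))
                            (cong (_+ 0) (trans (total-replicate isPart (g ∸ m) one) (*-zeroʳ (g ∸ m))))
  ... | no m≰g = trans (cong suc (#parts-encode₂ gs a)) (cong length (sym (filter-accept (_<? m) (≰⇒> m≰g))))

  PrecededByLarge : List ℕ → Set
  PrecededByLarge pre = ∃ λ pre′ → ∃ λ h → pre ≡ pre′ ∷ʳ h × m ≤ h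

  FollowedByLarge : List ℕ → Set
  FollowedByLarge post = post ≡ [] ⊎ (∃ λ h → ∃ λ post′ → post ≡ h ∷ post′ × m < h)

  IsolatedExceptions : List ℕ → Set
  IsolatedExceptions gs = ∀ (pre : List ℕ) (g : ℕ) (post : List ℕ) →
    gs ≡ pre ++ (g ∷ post) → g < m → PrecededByLarge pre × FollowedByLarge post

  -- The state reached after reading the gaps q records whether q ends with a large or an exceptional gap.
  EndsIn : State → List ℕ → Set
  EndsIn start     q = q ≡ []
  EndsIn afterFull q = PrecededByLarge q
  EndsIn afterPart q = ∃ λ q′ → ∃ λ h → q ≡ q′ ∷ʳ h × h < m

  isolatedExceptions⇒isolated : ∀ s q gs → EndsIn s q → IsolatedExceptions (q ++ gs) → Isolated s gs
  isolatedExceptions⇒isolated s q []       _    _  = []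
  isolatedExceptions⇒isolated s q (g ∷ gs) ends ie with m ≤? g
  ... | yes m≤g = large∷ m≤g (far s ends) (isolatedExceptions⇒isolated afterFull (q ∷ʳ g) gs (q , g , refl , m≤g) ie′)
    where
    ie′ : IsolatedExceptions ((q ∷ʳ g) ++ gs)
    ie′ pre x post eq = ie pre x post (trans (sym (++-assoc q (g ∷ []) gs)) eq)
    far : ∀ s → EndsIn s q → s ≡ afterPart → m < g
    far afterPart (q′ , h , refl , h<m) refl with ie q′ h (g ∷ gs) (++-assoc q′ (h ∷ []) (g ∷ gs)) h<m
    ... | _ , inj₂ (_ , _ , refl , m<g) = m<g
  ... | no m≰g = small s ends
    where
    g<m = ≰⇒> m≰g
    preceded : PrecededByLarge q
    preceded = proj₁ (ie q g gs refl g<m)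
    ie′ : IsolatedExceptions ((q ∷ʳ g) ++ gs)
    ie′ pre x post eq = ie pre x post (trans (sym (++-assoc q (g ∷ []) gs)) eq)
    small : ∀ s → EndsIn s q → Isolated s (g ∷ gs)
    small start refl with preceded
    ... | [] , _ , () , _
    ... | _ ∷ _ , _ , () , _
    small afterFull _ = small∷ g<m (isolatedExceptions⇒isolated afterPart (q ∷ʳ g) gs (q , g , refl , g<m) ie′)
    small afterPart (q′ , h , q≡ , h<m) with preceded
    ... | q″ , h′ , q≡′ , m≤h′ = contradiction (subst (m ≤_) (sym (proj₂ (∷ʳ-injective q′ q″ (trans (sym q≡) q≡′)))) m≤h′) (<⇒≱ h<m)

  isolated⇒isolatedExceptions : ∀ {s gs} q → Isolated s gs → EndsIn s q → ∀ pre x post →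
                                gs ≡ pre ++ x ∷ post → x < m → PrecededByLarge (q ++ pre) × FollowedByLarge post
  isolated⇒isolatedExceptions q []                  _    []      _ _ () _
  isolated⇒isolatedExceptions q []                  _    (_ ∷ _) _ _ () _
  isolated⇒isolatedExceptions q (large∷ m≤g _ _)    _    []      _ _ refl x<m = contradiction m≤g (<⇒≱ x<m)
  isolated⇒isolatedExceptions q (small∷ g<m iso)    ends []      _ _ refl _   =
    subst PrecededByLarge (sym (++-identityʳ q)) ends , followed iso
    where
    followed : ∀ {gs} → Isolated afterPart gs → FollowedByLarge gs
    followed []                 = inj₁ refl
    followed (large∷ _ far _)   = inj₂ (_ , _ , refl , far refl)
  isolated⇒isolatedExceptions {gs = g ∷ _} q (large∷ m≤g _ iso) _ (_ ∷ pre) x post eq x<m with ∷-injective eq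
  ... | refl , eq′ =
    map₁ (subst PrecededByLarge (++-assoc q (g ∷ []) pre))
      (isolated⇒isolatedExceptions (q ∷ʳ g) iso (q , g , refl , m≤g) pre x post eq′ x<m)
  isolated⇒isolatedExceptions {gs = g ∷ _} q (small∷ g<m iso) _ (_ ∷ pre) x post eq x<m with ∷-injective eq
  ... | refl , eq′ =
    map₁ (subst PrecededByLarge (++-assoc q (g ∷ []) pre))
      (isolated⇒isolatedExceptions (q ∷ʳ g) iso (q , g , refl , g<m) pre x post eq′ x<m)

  isolatedExceptions⇔isolated : ∀ gs → IsolatedExceptions gs ⇔ Isolated start gs
  isolatedExceptions⇔isolated gs =
    mk⇔ (isolatedExceptions⇒isolated start [] gs refl) (λ iso → isolated⇒isolatedExceptions [] iso refl)

  AcceptedWord : ℕ → ℕ → Word → Set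
  AcceptedWord n k w = Accepts start w × wordWeight w ≡ n × #parts w ≡ k

  profiles↔words : ∀ {n k} → (λ L → weight L ≡ n × AdmissibleProfile k L) ↔ˢ AcceptedWord n k
  profiles↔words {n} {k} =
    ↔ˢ-byEncoding encode₁ (decode₁ 0) decode₁-encode₁ (λ (acc , _) → encode₁-decode₁ 0 acc (λ _ → refl)) profile⇔word
    where
    profile⇔word : ∀ L → (weight L ≡ n × AdmissibleProfile k L) ⇔ AcceptedWord n k (encode₁ L)
    profile⇔word L = mk⇔
      (λ (w , adm , c) → Equivalence.to (encode₁-accepted⇔ L) adm ,
                         trans (wordWeight-encode₁ L) w , trans (#parts-encode₁ L) c)
      (λ (acc , w , c) → trans (sym (wordWeight-encode₁ L)) w ,
                         Equivalence.from (encode₁-accepted⇔ L) acc , trans (sym (#parts-encode₁ L)) c)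

  Family2Gaps : ℕ → List ℕ → ℕ → Set
  Family2Gaps k gs _ = length (filter (_<? m) gs) ≡ k × IsolatedExceptions gs

  encode₂-accepted-positive : ∀ {n} gs a → 1 ≤ n → Accepts start (encode₂ gs a) → wordWeight (encode₂ gs a) ≡ n → 1 ≤ a
  encode₂-accepted-positive gs (suc a) _ _ _ = s≤s z≤n
  encode₂-accepted-positive gs zero 1≤n acc w with encode₂-zero-accepted gs acc
  ... | _ , refl = contradiction (subst (1 ≤_) (sym w) 1≤n) λ ()

  gapSequences↔words : ∀ {n k} → 1 ≤ n → GapSequence n (Family2Gaps k) ↔ˢ AcceptedWord n k
  gapSequences↔words {n} {k} 1≤n =
    ↔ˢ-byEncoding (uncurry encode₂) (decode₂ 0) (λ (gs , a) → decode₂-encode₂ gs a)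
      (λ (acc , _) → encode₂-decode₂ 0 acc (λ _ → refl)) gaps⇔word
    where
    gaps⇔word : ∀ x → GapSequence n (Family2Gaps k) x ⇔ AcceptedWord n k (uncurry encode₂ x)
    gaps⇔word (gs , a) = mk⇔
      (λ ((1≤a , w) , c , ie) → encode₂-accepted a (Equivalence.to (isolatedExceptions⇔isolated gs) ie) 1≤a ,
                                trans (wordWeight-encode₂ gs a) w , trans (#parts-encode₂ gs a) c)
      (λ (acc , w , c) → (encode₂-accepted-positive gs a 1≤n acc w , trans (sym (wordWeight-encode₂ gs a)) w) ,
                         trans (sym (#parts-encode₂ gs a)) c ,
                         Equivalence.from (isolatedExceptions⇔isolated gs) (encode₂-accepted⁻ gs a acc))

theorem1p6 : (n m k : ℕ) → 1 ≤ n → 1 ≤ m →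
    Equinumerous (λ p → PerimPartition n p × Family1 m k p)
                 (λ p → PerimPartition n p × Family2 m k p)
theorem1p6 n m k 1≤n _ = ↔ˢ⇒equinumerous
  (↔ˢ-sym (gapSequences↔perimPartitions {R = λ gs a → AdmissibleProfile m k (gs ∷ʳ (a ∸ 1))} (family1⇔admissibleProfile m))
   ⨾ gapSequences↔profiles 1≤n
   ⨾ profiles↔words m
   ⨾ ↔ˢ-sym (gapSequences↔words m 1≤n)
   ⨾ gapSequences↔perimPartitions (λ _ → mk⇔ id id))
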